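{- Let $n\in\mathbb{N}$. The maximum of $c_a$ over $a\in\mathcal{A}_n$ is attained at some element of $$\mathcal{M}_n=\{(a_1,\ldots,a_n)\in\mathcal{A}_n : a_{i+1}\le a_i\le a_{i+1}+1 \text{ for all } 1\le i\le n-1\}.$$
   Context: For $n\in\mathbb{N}$ and indeterminates $x_1,\ldots,x_n$, let $p_n=x_1(x_1+x_2)\cdots(x_1+x_2+\cdots+x_n)$. Let $\mathbb{N}_0=\mathbb{N}\cup\{0\}$ and $\mathcal{A}_n=\{(a_1,\ldots,a_n)\in\mathbb{N}_0^n : \sum_{i=k+1}^n a_i\le n-k \text{ for all } 1\le k\le n-1,\ \sum_{i=1}^n a_i=n\}$; these are exactly the exponent vectors of the monomials of $p_n$. For $a\in\mathcal{A}_n$, $c_a$ denotes the coefficient of $x_1^{a_1}\cdots x_n^{a_n}$ in the expansion of $p_n$. -}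

module Defs where

open import Data.Nat using (ℕ; zero; suc; _+_; _∸_; _≤_; _<_; _<?_)
open import Data.Fin using (Fin; toℕ)
import Data.Fin as F
open import Data.Vec using (Vec; tabulate; zipWith; replicate; lookup; toList)
open import Data.Vec.Properties using (≡-dec)
open import Data.List using (List; []; _∷_; map; concatMap; filter; foldr; upTo; allFin; drop; length)
open import Data.Nat.ListAction using (sum)
open import Data.Bool using (if_then_else_)
open import Data.Product using (_×_)
open import Relation.Nullary using (does)
open import Relation.Binary.PropositionalEquality using (_≡_)
import Data.Nat as N

-- A polynomial in x_1..x_n with natural coefficients, represented as a
-- formal (unreduced) sum of monomials: a list of exponent vectors, where
-- each monomial occurs as many times as its coefficient.
Poly : ℕ → Set
Poly n = List (Vec ℕ n)

-- the variable x_{i+1} (Fin is 0-indexed)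
var : ∀ {n} → Fin n → Poly n
var i = tabulate (λ j → if does (i F.≟ j) then 1 else 0) ∷ []

one : ∀ {n} → Poly n
one = replicate _ 0 ∷ []

_⊕_ : ∀ {n} → Poly n → Poly n → Poly n
p ⊕ q = p Data.List.++ q

_⊗_ : ∀ {n} → Poly n → Poly n → Poly n
p ⊗ q = concatMap (λ m → map (zipWith _+_ m) q) p

partialSum : (n k : ℕ) → Poly n
partialSum n k = foldr _⊕_ [] (map var (filter (λ i → toℕ i <? k) (allFin n)))

p : (n : ℕ) → Poly n
p n = foldr _⊗_ one (map (λ k → partialSum n (suc k)) (upTo n))

coeff : ∀ {n} → Vec ℕ n → Poly n → ℕ
coeff a q = length (filter (λ m → ≡-dec N._≟_ m a) q)

c : (n : ℕ) → Vec ℕ n → ℕ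
c n a = coeff a (p n)

-- membership in 𝒜_n.  With 0-indexed lists, sum_{i=k+1}^n a_i = sum (drop k a).
InA : (n : ℕ) → Vec ℕ n → Set
InA n a = (∀ (k : ℕ) → 1 ≤ k → k ≤ n ∸ 1 → sum (drop k (toList a)) ≤ n ∸ k)
        × sum (toList a) ≡ n

InM : (n : ℕ) → Vec ℕ n → Set
InM n a = InA n a
        × (∀ (i j : Fin n) → toℕ j ≡ suc (toℕ i) →
             (lookup a j ≤ lookup a i) × (lookup a i ≤ lookup a j + 1))

module Submission where

-- Expanding the factors of p_n one at a time gives the closed form
-- c_a = Π_k C(a₁ + ⋯ + a_k − k + 1, a_k); while the first k factors are expanded the first k
-- variables play symmetric roles, so the induction runs through multinomial coefficients and
-- their Pascal rule. Now take a maximiser of c over the finite support of p_n. Where two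
-- neighbours violate aᵢ₊₁ ≤ aᵢ ≤ aᵢ₊₁ + 1, moving one unit between them multiplies c by a ratio
-- of binomial coefficients that is at least 1, and lowers Σ aᵢ² + Σ (i − 1) aᵢ. Repeating such
-- moves ends in ℳ_n, still at the maximum; a positive coefficient already forces membership in 𝒜_n.

open import Data.Bool using (true; false; if_then_else_)
open import Data.Empty using (⊥-elim)
open import Data.Fin as Fin using (Fin; toℕ)
open import Data.List as List using (List; []; _∷_; _++_; length; map; filter; foldr; allFin; drop; applyUpTo)
open import Data.List.Extrema.Nat using (argmax; f[xs]≤f[argmax])
open import Data.List.Membership.Propositional using (_∈_)
open import Data.List.Membership.Propositional.Properties using (∈-filter⁻)
import Data.List.Properties as List
import Data.List.Relation.Unary.All as All
open import Data.List.Relation.Unary.Any using (here)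
open import Data.Nat
open import Data.Nat.Combinatorics using (_C_; nCn≡1; nC1≡n; nCk≡nC[n∸k]; k>n⇒nCk≡0; nCk+nC[k+1]≡[n+1]C[k+1])
open import Data.Nat.Induction using (<-wellFounded)
open import Data.Nat.ListAction using (sum)
open import Data.Nat.ListAction.Properties using (sum-++)
open import Data.Nat.Properties
open import Data.Nat.Tactic.RingSolver using (solve-∀)
open import Data.Product using (Σ; ∃; _×_; _,_)
open import Data.Sum using (_⊎_; inj₁; inj₂)
open import Data.Unit using (⊤; tt)
open import Data.Vec as Vec using (Vec; []; _∷_; toList; replicate; tabulate; zipWith; _[_]%=_)
open import Data.Vec.Properties using (≡-dec; length-toList; lookup∘updateAt; updateAt-updateAt; updateAt-id-local; updateAt-id)
open import Function using (_∘_)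
open import Induction.WellFounded using (Acc; acc)
open import Relation.Nullary using (yes; no; does)
open import Relation.Binary.PropositionalEquality

open import Defs

nC0≡1 : ∀ n → n C 0 ≡ 1
nC0≡1 n = trans (nCk≡nC[n∸k] {0} {n} z≤n) (nCn≡1 n)

[n+1]C[k+1]*[k+1]≡nCk*[n+1] : ∀ n k → (suc n C suc k) * suc k ≡ (n C k) * suc n
[n+1]C[k+1]*[k+1]≡nCk*[n+1] zero    zero    = refl
[n+1]C[k+1]*[k+1]≡nCk*[n+1] zero    (suc k) = refl
[n+1]C[k+1]*[k+1]≡nCk*[n+1] (suc n) zero    = begin
  (suc (suc n) C 1) * 1     ≡⟨ *-identityʳ _ ⟩
  suc (suc n) C 1           ≡⟨ nC1≡n (suc (suc n)) ⟩
  suc (suc n)               ≡⟨ *-identityˡ _ ⟨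
  1 * suc (suc n)           ≡⟨ cong (_* suc (suc n)) (nC0≡1 (suc n)) ⟨
  (suc n C 0) * suc (suc n) ∎
  where open ≡-Reasoning
[n+1]C[k+1]*[k+1]≡nCk*[n+1] (suc n) (suc k) = begin
  (suc (suc n) C suc (suc k)) * suc (suc k)
    ≡⟨ cong (_* suc (suc k)) (nCk+nC[k+1]≡[n+1]C[k+1] (suc n) (suc k)) ⟨
  (A + B) * suc (suc k)
    ≡⟨ expand A B k ⟩
  A * suc k + A + B * suc (suc k)
    ≡⟨ cong₂ (λ x y → x + A + y) ([n+1]C[k+1]*[k+1]≡nCk*[n+1] n k) ([n+1]C[k+1]*[k+1]≡nCk*[n+1] n (suc k)) ⟩
  (n C k) * suc n + A + (n C suc k) * suc n
    ≡⟨ collect (n C k) (n C suc k) A n ⟩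
  (n C k + n C suc k) * suc n + A
    ≡⟨ cong (λ x → x * suc n + A) (nCk+nC[k+1]≡[n+1]C[k+1] n k) ⟩
  A * suc n + A
    ≡⟨ +-comm (A * suc n) A ⟩
  A + A * suc n
    ≡⟨ *-suc A (suc n) ⟨
  A * suc (suc n) ∎
  where
  open ≡-Reasoning
  A = suc n C suc k
  B = suc n C suc (suc k)
  expand : ∀ A B k → (A + B) * suc (suc k) ≡ A * suc k + A + B * suc (suc k)
  expand = solve-∀
  collect : ∀ X Y A n → X * suc n + A + Y * suc n ≡ (X + Y) * suc n + A
  collect = solve-∀

[s+k]C[k+1]*[k+1]≡[s+k]Ck*s : ∀ s k → ((s + k) C suc k) * suc k ≡ ((s + k) C k) * s
[s+k]C[k+1]*[k+1]≡[s+k]Ck*s s k = +-cancelˡ-≡ (A * suc k) _ _ (begin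
  A * suc k + B * suc k     ≡⟨ *-distribʳ-+ (suc k) A B ⟨
  (A + B) * suc k           ≡⟨ cong (_* suc k) (nCk+nC[k+1]≡[n+1]C[k+1] (s + k) k) ⟩
  (suc (s + k) C suc k) * suc k ≡⟨ [n+1]C[k+1]*[k+1]≡nCk*[n+1] (s + k) k ⟩
  A * suc (s + k)           ≡⟨ cong (λ m → A * suc m) (+-comm s k) ⟩
  A * (suc k + s)           ≡⟨ *-distribˡ-+ A (suc k) s ⟩
  A * suc k + A * s         ∎)
  where
  open ≡-Reasoning
  A = (s + k) C k
  B = (s + k) C suc k

-- The closed form of c_a

-- weight 0 a = Π_k C(a₁ + ⋯ + a_k − k + 1, a_k), cut to 0 as soon as some a₁ + ⋯ + a_k < k
-- with k < n, or a₁ + ⋯ + a_n ≠ n; the argument u carries a₁ + ⋯ + a_k − k.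
mutual
  weight : ℕ → List ℕ → ℕ
  weight u       (x ∷ xs) = ((u + x) C x) * weight⁻ (u + x) xs
  weight zero    []       = 1
  weight (suc _) []       = 0

  weight⁻ : ℕ → List ℕ → ℕ
  weight⁻ zero    xs = 0
  weight⁻ (suc u) xs = weight u xs

∂ : (List ℕ → ℕ) → List ℕ → ℕ
∂ f []          = 0
∂ f (zero ∷ v)  = ∂ (f ∘ (0 ∷_)) v
∂ f (suc x ∷ v) = f (x ∷ v) + ∂ (f ∘ (suc x ∷_)) v

∂-cong : ∀ v {f g : List ℕ → ℕ} → (∀ w → suc (sum w) ≡ sum v → f w ≡ g w) → ∂ f v ≡ ∂ g v
∂-cong []          f≡g = refl
∂-cong (zero ∷ v)  f≡g = ∂-cong v (λ w → f≡g (0 ∷ w))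
∂-cong (suc x ∷ v) f≡g = cong₂ _+_ (f≡g (x ∷ v) refl)
  (∂-cong v (λ w Σw+1≡Σv → f≡g (suc x ∷ w) (trans (sym (+-suc (suc x) (sum w))) (cong (suc x +_) Σw+1≡Σv))))

∂-*ˡ : ∀ v c (f : List ℕ → ℕ) → ∂ (λ w → c * f w) v ≡ c * ∂ f v
∂-*ˡ []          c f = sym (*-zeroʳ c)
∂-*ˡ (zero ∷ v)  c f = ∂-*ˡ v c (f ∘ (0 ∷_))
∂-*ˡ (suc x ∷ v) c f =
  trans (cong (c * f (x ∷ v) +_) (∂-*ˡ v c (f ∘ (suc x ∷_)))) (sym (*-distribˡ-+ c _ _))

∂-*ʳ : ∀ v c (f : List ℕ → ℕ) → ∂ (λ w → f w * c) v ≡ ∂ f v * c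
∂-*ʳ v c f = trans (∂-cong v (λ w _ → *-comm (f w) c)) (trans (∂-*ˡ v c f) (*-comm c (∂ f v)))

ifPos : ℕ → ℕ → ℕ
ifPos zero    _ = 0
ifPos (suc _) m = m

-- multinomial s v = (s + Σ v)! / (s! · Π vᵢ!)
multinomial : ℕ → List ℕ → ℕ
multinomial s []       = 1
multinomial s (x ∷ xs) = ((s + x) C x) * multinomial (s + x) xs

multinomial-0∷ : ∀ s w → multinomial s (0 ∷ w) ≡ multinomial s w
multinomial-0∷ s w = begin
  ((s + 0) C 0) * multinomial (s + 0) w ≡⟨ cong (λ t → (t C 0) * multinomial t w) (+-identityʳ s) ⟩
  (s C 0) * multinomial s w             ≡⟨ cong (_* multinomial s w) (nC0≡1 s) ⟩
  1 * multinomial s w                   ≡⟨ *-identityˡ (multinomial s w) ⟩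
  multinomial s w                       ∎
  where open ≡-Reasoning

multinomial-suc∷ : ∀ s x w → multinomial s (suc x ∷ w) ≡ (suc (s + x) C suc x) * multinomial (suc (s + x)) w
multinomial-suc∷ s x w = cong (λ t → (t C suc x) * multinomial t w) (+-suc s x)

multinomial-zeros : ∀ s v → sum v ≡ 0 → multinomial s v ≡ 1
multinomial-zeros s []         _   = refl
multinomial-zeros s (zero ∷ v) Σ≡0 = trans (multinomial-0∷ s v) (multinomial-zeros s v Σ≡0)

multinomial-∷ʳ : ∀ s lo h → multinomial s (lo ++ h ∷ []) ≡ multinomial s lo * ((s + sum lo + h) C h)
multinomial-∷ʳ s []       h = begin
  ((s + h) C h) * 1     ≡⟨ *-identityʳ ((s + h) C h) ⟩
  (s + h) C h           ≡⟨ cong (λ t → (t + h) C h) (+-identityʳ s) ⟨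
  (s + 0 + h) C h       ≡⟨ *-identityˡ ((s + 0 + h) C h) ⟨
  1 * ((s + 0 + h) C h) ∎
  where open ≡-Reasoning
multinomial-∷ʳ s (b ∷ bs) h = begin
  B * multinomial (s + b) (bs ++ h ∷ [])            ≡⟨ cong (B *_) (multinomial-∷ʳ (s + b) bs h) ⟩
  B * (multinomial (s + b) bs * ((s + b + sum bs + h) C h)) ≡⟨ *-assoc B _ _ ⟨
  B * multinomial (s + b) bs * ((s + b + sum bs + h) C h)   ≡⟨ cong (λ t → B * multinomial (s + b) bs * ((t + h) C h)) (+-assoc s b (sum bs)) ⟩
  B * multinomial (s + b) bs * ((s + (b + sum bs) + h) C h) ∎
  where
  open ≡-Reasoning
  B = (s + b) C b

multinomial-pred : ∀ s x w → ifPos s (multinomial (pred s) (suc x ∷ w)) ≡ ((s + x) C suc x) * multinomial (s + x) w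
multinomial-pred zero    x w = sym (cong (_* multinomial x w) (k>n⇒nCk≡0 (n<1+n x)))
multinomial-pred (suc s) x w = multinomial-suc∷ s x w

ifPos-+-suc : ∀ s k m → ifPos (s + suc k) m ≡ m
ifPos-+-suc s k m = cong (λ t → ifPos t m) (+-suc s k)

multinomial-pascal : ∀ s v → ∂ (multinomial s) v + ifPos s (multinomial (pred s) v) ≡ ifPos (s + sum v) (multinomial s v)
multinomial-pascal zero    []          = refl
multinomial-pascal (suc s) []          = refl
multinomial-pascal s       (zero ∷ w)  = begin
  ∂ (multinomial s ∘ (0 ∷_)) w + ifPos s (multinomial (pred s) (0 ∷ w))
    ≡⟨ cong₂ _+_ (∂-cong w (λ w′ _ → multinomial-0∷ s w′)) (cong (ifPos s) (multinomial-0∷ (pred s) w)) ⟩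
  ∂ (multinomial s) w + ifPos s (multinomial (pred s) w)
    ≡⟨ multinomial-pascal s w ⟩
  ifPos (s + sum w) (multinomial s w)
    ≡⟨ cong (ifPos (s + sum w)) (multinomial-0∷ s w) ⟨
  ifPos (s + sum w) (multinomial s (0 ∷ w)) ∎
  where open ≡-Reasoning
multinomial-pascal s       (suc x ∷ w) = begin
  multinomial s (x ∷ w) + ∂ (multinomial s ∘ (suc x ∷_)) w + ifPos s (multinomial (pred s) (suc x ∷ w))
    ≡⟨ cong₂ (λ d e → (t C x) * M t + d + e)
         (trans (∂-cong w (λ w′ _ → multinomial-suc∷ s x w′)) (∂-*ˡ w B (multinomial (suc t))))
         (multinomial-pred s x w) ⟩
  (t C x) * M t + B * D + (t C suc x) * M t
    ≡⟨ regroup (t C x) (t C suc x) (M t) B D ⟩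
  B * D + ((t C x) + (t C suc x)) * M t
    ≡⟨ cong (λ e → B * D + e * M t) (nCk+nC[k+1]≡[n+1]C[k+1] t x) ⟩
  B * D + B * M t
    ≡⟨ *-distribˡ-+ B D (M t) ⟨
  B * (D + M t)
    ≡⟨ cong (B *_) (multinomial-pascal (suc t) w) ⟩
  B * multinomial (suc t) w
    ≡⟨ multinomial-suc∷ s x w ⟨
  multinomial s (suc x ∷ w)
    ≡⟨ ifPos-+-suc s (x + sum w) (multinomial s (suc x ∷ w)) ⟨
  ifPos (s + (suc x + sum w)) (multinomial s (suc x ∷ w)) ∎
  where
  open ≡-Reasoning
  t = s + x
  B = suc t C suc x
  M = λ r → multinomial r w
  D = ∂ (multinomial (suc t)) w
  regroup : ∀ p q m r d → p * m + r * d + q * m ≡ r * d + (p + q) * m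
  regroup = solve-∀

unit : ∀ {n} → Fin n → Vec ℕ n
unit i = tabulate (λ j → if does (i Fin.≟ j) then 1 else 0)

sumOfVars≡units : ∀ {n} (is : List (Fin n)) → foldr _⊕_ [] (map var is) ≡ map unit is
sumOfVars≡units []       = refl
sumOfVars≡units (i ∷ is) = cong (unit i ∷_) (sumOfVars≡units is)

unit-+ : ∀ {n} (i : Fin n) m → zipWith _+_ (unit i) m ≡ m [ i ]%= suc
unit-+ Fin.zero    (x ∷ m) = cong (suc x ∷_) (zeros-+ m)
  where
  zeros-+ : ∀ {n} (m : Vec ℕ n) → zipWith _+_ (tabulate (λ _ → 0)) m ≡ m
  zeros-+ []      = refl
  zeros-+ (x ∷ m) = cong (x ∷_) (zeros-+ m)
unit-+ (Fin.suc i) (x ∷ m) = cong (x ∷_) (unit-+ i m)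

lookup-unit-+ : ∀ {n} (i : Fin n) m → Vec.lookup (zipWith _+_ (unit i) m) i ≡ suc (Vec.lookup m i)
lookup-unit-+ i m = trans (cong (λ v → Vec.lookup v i) (unit-+ i m)) (lookup∘updateAt i m)

coeff-++ : ∀ {n} (a : Vec ℕ n) P Q → coeff a (P ++ Q) ≡ coeff a P + coeff a Q
coeff-++ a P Q = trans (cong length (List.filter-++ (λ m → ≡-dec _≟_ m a) P Q)) (List.length-++ (filter (λ m → ≡-dec _≟_ m a) P))

coeff-⊗ : ∀ {n} (a : Vec ℕ n) P Q → coeff a (P ⊗ Q) ≡ sum (map (λ m → coeff a (map (zipWith _+_ m) Q)) P)
coeff-⊗ a []      Q = refl
coeff-⊗ a (m ∷ P) Q = trans (coeff-++ a (map (zipWith _+_ m) Q) (P ⊗ Q)) (cong (_ +_) (coeff-⊗ a P Q))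

coeff-map : ∀ {n} {f : Vec ℕ n → Vec ℕ n} {a b} → (∀ m → f m ≡ a → m ≡ b) → f b ≡ a → ∀ Q → coeff a (map f Q) ≡ coeff b Q
coeff-map fm≡a⇒m≡b fb≡a [] = refl
coeff-map {f = f} {a} {b} fm≡a⇒m≡b fb≡a (m ∷ Q) with ≡-dec _≟_ (f m) a | ≡-dec _≟_ m b
... | yes _     | yes _   = cong suc (coeff-map fm≡a⇒m≡b fb≡a Q)
... | yes fm≡a  | no m≢b  = ⊥-elim (m≢b (fm≡a⇒m≡b m fm≡a))
... | no  fm≢a  | yes refl = ⊥-elim (fm≢a fb≡a)
... | no  _     | no _    = coeff-map fm≡a⇒m≡b fb≡a Q

coeff-map-∉ : ∀ {n} {f : Vec ℕ n → Vec ℕ n} {a} → (∀ m → f m ≢ a) → ∀ Q → coeff a (map f Q) ≡ 0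
coeff-map-∉ fm≢a [] = refl
coeff-map-∉ {f = f} {a} fm≢a (m ∷ Q) with ≡-dec _≟_ (f m) a
... | yes fm≡a = ⊥-elim (fm≢a m fm≡a)
... | no  _    = coeff-map-∉ fm≢a Q

coeff-shift : ∀ {n} (a : Vec ℕ n) i Q →
  coeff a (map (zipWith _+_ (unit i)) Q) ≡ ifPos (Vec.lookup a i) (coeff (a [ i ]%= pred) Q)
coeff-shift a i Q with Vec.lookup a i in aᵢ≡
... | zero  = coeff-map-∉ shift≢a Q
  where
  shift≢a : ∀ m → zipWith _+_ (unit i) m ≢ a
  shift≢a m e = 0≢1+n (begin
    0                                          ≡⟨ aᵢ≡ ⟨
    Vec.lookup a i                             ≡⟨ cong (λ v → Vec.lookup v i) e ⟨
    Vec.lookup (zipWith _+_ (unit i) m) i      ≡⟨ lookup-unit-+ i m ⟩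
    suc (Vec.lookup m i)                       ∎)
    where open ≡-Reasoning
... | suc _ = coeff-map unshift reshift Q
  where
  open ≡-Reasoning
  unshift : ∀ m → zipWith _+_ (unit i) m ≡ a → m ≡ a [ i ]%= pred
  unshift m e = begin
    m                              ≡⟨ updateAt-id i m ⟨
    m [ i ]%= (pred ∘ suc)         ≡⟨ updateAt-updateAt i m ⟨
    (m [ i ]%= suc) [ i ]%= pred   ≡⟨ cong (_[ i ]%= pred) (trans (sym (unit-+ i m)) e) ⟩
    a [ i ]%= pred                 ∎
  reshift : zipWith _+_ (unit i) (a [ i ]%= pred) ≡ a
  reshift = begin
    zipWith _+_ (unit i) (a [ i ]%= pred) ≡⟨ unit-+ i (a [ i ]%= pred) ⟩
    (a [ i ]%= pred) [ i ]%= suc          ≡⟨ updateAt-updateAt i a ⟩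
    a [ i ]%= (suc ∘ pred)                ≡⟨ updateAt-id-local i a (trans (cong (suc ∘ pred) aᵢ≡) (sym aᵢ≡)) ⟩
    a                                     ∎

filter-<-suc : ∀ {m n} k (g : Fin m → Fin n) →
  filter (λ i → toℕ i <? suc k) (List.tabulate (Fin.suc ∘ g)) ≡ map Fin.suc (filter (λ i → toℕ i <? k) (List.tabulate g))
filter-<-suc {zero}  k g = refl
filter-<-suc {suc m} k g with does (toℕ (g Fin.zero) <? k)
... | true  = cong (Fin.suc (g Fin.zero) ∷_) (filter-<-suc k (g ∘ Fin.suc))
... | false = filter-<-suc k (g ∘ Fin.suc)

sum-filter-<-suc : ∀ {n} k (h : Fin (suc n) → ℕ) →
  sum (map h (filter (λ i → toℕ i <? suc k) (allFin (suc n))))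
    ≡ h Fin.zero + sum (map (h ∘ Fin.suc) (filter (λ i → toℕ i <? k) (allFin n)))
sum-filter-<-suc k h = cong (λ hs → h Fin.zero + sum hs)
  (trans (cong (map h) (filter-<-suc k (λ i → i))) (sym (List.map-∘ (filter (λ i → toℕ i <? k) (allFin _)))))

sum-filter-<-zero : ∀ {n} (h : Fin n → ℕ) (is : List (Fin n)) → sum (map h (filter (λ i → toℕ i <? 0) is)) ≡ 0
sum-filter-<-zero h []       = refl
sum-filter-<-zero h (i ∷ is) = sum-filter-<-zero h is

∂-decrements : ∀ {n k} (a : Vec ℕ n) v hi (F : Vec ℕ n → ℕ) (g : List ℕ → ℕ) →
  toList a ≡ v ++ hi → length v ≡ k → (∀ b w → toList b ≡ w ++ hi → length w ≡ k → F b ≡ g w) →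
  sum (map (λ i → ifPos (Vec.lookup a i) (F (a [ i ]%= pred))) (filter (λ i → toℕ i <? k) (allFin n))) ≡ ∂ g v
∂-decrements {n} a   []      hi F g _ refl _ =
  sum-filter-<-zero (λ i → ifPos (Vec.lookup a i) (F (a [ i ]%= pred))) (allFin n)
∂-decrements {suc n} (x ∷ a) (y ∷ v) hi F g a≡ refl F≡g with List.∷-injective a≡
... | refl , a≡v++hi = trans (sum-filter-<-suc (length v) (λ i → ifPos (Vec.lookup (x ∷ a) i) (F ((x ∷ a) [ i ]%= pred))))
                               (first x rest)
  where
  rest : sum (map (λ i → ifPos (Vec.lookup a i) (F (x ∷ a [ i ]%= pred))) (filter (λ i → toℕ i <? length v) (allFin n))) ≡ ∂ (g ∘ (x ∷_)) v
  rest = ∂-decrements a v hi (F ∘ (x ∷_)) (g ∘ (x ∷_)) a≡v++hi refl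
    (λ b w b≡w++hi |w|≡ → F≡g (x ∷ b) (x ∷ w) (cong (x ∷_) b≡w++hi) (cong suc |w|≡))
  first : ∀ x {r} → r ≡ ∂ (g ∘ (x ∷_)) v → ifPos x (F (pred x ∷ a)) + r ≡ ∂ g (x ∷ v)
  first zero    r≡ = r≡
  first (suc x) r≡ = cong₂ _+_ (F≡g (x ∷ a) (x ∷ v) (cong (x ∷_) a≡v++hi) refl) r≡

coeff-partialSum-⊗ : ∀ {n k} (a : Vec ℕ n) v hi Q (g : List ℕ → ℕ) → toList a ≡ v ++ hi → length v ≡ k →
  (∀ b w → toList b ≡ w ++ hi → length w ≡ k → coeff b Q ≡ g w) → coeff a (partialSum n k ⊗ Q) ≡ ∂ g v
coeff-partialSum-⊗ {n} {k} a v hi Q g a≡v++hi |v|≡k coeff≡g = begin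
  coeff a (partialSum n k ⊗ Q)
    ≡⟨ cong (λ P → coeff a (P ⊗ Q)) (sumOfVars≡units is) ⟩
  coeff a (map unit is ⊗ Q)
    ≡⟨ coeff-⊗ a (map unit is) Q ⟩
  sum (map (λ m → coeff a (map (zipWith _+_ m) Q)) (map unit is))
    ≡⟨ cong sum (List.map-∘ is) ⟨
  sum (map (λ i → coeff a (map (zipWith _+_ (unit i)) Q)) is)
    ≡⟨ cong sum (List.map-cong (λ i → coeff-shift a i Q) is) ⟩
  sum (map (λ i → ifPos (Vec.lookup a i) (coeff (a [ i ]%= pred) Q)) is)
    ≡⟨ ∂-decrements a v hi (λ b → coeff b Q) g a≡v++hi |v|≡k coeff≡g ⟩
  ∂ g v ∎
  where
  open ≡-Reasoning
  is = filter (λ i → toℕ i <? k) (allFin n)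

partialSumProduct : (n k m : ℕ) → Poly n
partialSumProduct n k zero    = one
partialSumProduct n k (suc m) = partialSum n (suc k) ⊗ partialSumProduct n (suc k) m

p≡partialSumProduct : ∀ n → p n ≡ partialSumProduct n 0 n
p≡partialSumProduct n =
  trans (cong (foldr _⊗_ one) (List.map-upTo (λ k → partialSum n (suc k)) n)) (go n 0 (λ i → partialSum n (suc i)) (λ _ → refl))
  where
  go : ∀ m k f → (∀ i → f i ≡ partialSum n (suc (k + i))) → foldr _⊗_ one (applyUpTo f m) ≡ partialSumProduct n k m
  go zero    k f _  = refl
  go (suc m) k f f≡ = cong₂ _⊗_
    (trans (f≡ 0) (cong (λ t → partialSum n (suc t)) (+-identityʳ k)))
    (go m (suc k) (f ∘ suc) (λ i → trans (f≡ (suc i)) (cong (λ t → partialSum n (suc t)) (+-suc k i))))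

sum-zeros : ∀ n → sum (toList (replicate n 0)) ≡ 0
sum-zeros zero    = refl
sum-zeros (suc n) = sum-zeros n

sum≡0⇒zeros : ∀ {n} (a : Vec ℕ n) → sum (toList a) ≡ 0 → replicate n 0 ≡ a
sum≡0⇒zeros []         _   = refl
sum≡0⇒zeros (zero ∷ a) Σ≡0 = cong (0 ∷_) (sum≡0⇒zeros a Σ≡0)

coeff-one : ∀ {n} (a : Vec ℕ n) → coeff a one ≡ weight (sum (toList a)) []
coeff-one {n} a with ≡-dec _≟_ (replicate n 0) a | sum (toList a) in Σa
... | yes refl | zero  = refl
... | yes refl | suc _ = ⊥-elim (0≢1+n (trans (sym (sum-zeros n)) Σa))
... | no  0≢a  | zero  = ⊥-elim (0≢a (sum≡0⇒zeros a Σa))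
... | no  _    | suc _ = refl

ifPos-* : ∀ t m hi → ifPos t m * weight (pred t) hi ≡ m * weight⁻ t hi
ifPos-* zero    m hi = sym (*-zeroʳ m)
ifPos-* (suc t) m hi = refl

coeff-partialSumProduct : ∀ {n k} hi lo (a : Vec ℕ n) → length lo ≡ k → toList a ≡ lo ++ hi →
  coeff a (partialSumProduct n k (length hi)) ≡ multinomial 0 lo * weight (sum lo) hi
coeff-partialSumProduct []       lo a _ a≡lo = begin
  coeff a one                            ≡⟨ coeff-one a ⟩
  weight (sum (toList a)) []             ≡⟨ cong (λ l → weight (sum l) []) (trans a≡lo (List.++-identityʳ lo)) ⟩
  weight (sum lo) []                     ≡⟨ empty lo ⟩
  multinomial 0 lo * weight (sum lo) []  ∎
  where
  open ≡-Reasoning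
  empty : ∀ lo → weight (sum lo) [] ≡ multinomial 0 lo * weight (sum lo) []
  empty lo with sum lo in Σlo
  ... | zero  = cong (_* 1) (sym (multinomial-zeros 0 lo Σlo))
  ... | suc _ = sym (*-zeroʳ (multinomial 0 lo))
coeff-partialSumProduct {n} {k} (h ∷ hi) lo a |lo|≡k a≡ = begin
  coeff a (partialSum n (suc k) ⊗ partialSumProduct n (suc k) (length hi))
    ≡⟨ coeff-partialSum-⊗ a v hi _ (λ w → multinomial 0 w * weight (sum w) hi) a≡v++hi |v|≡
         (λ b w b≡w++hi |w|≡ → coeff-partialSumProduct hi w b |w|≡ b≡w++hi) ⟩
  ∂ (λ w → multinomial 0 w * weight (sum w) hi) v
    ≡⟨ ∂-cong v (λ w Σw+1≡Σv → cong (λ s → multinomial 0 w * weight s hi) (cong pred Σw+1≡Σv)) ⟩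
  ∂ (λ w → multinomial 0 w * K) v
    ≡⟨ ∂-*ʳ v K (multinomial 0) ⟩
  ∂ (multinomial 0) v * K
    ≡⟨ cong (_* K) (trans (sym (+-identityʳ _)) (multinomial-pascal 0 v)) ⟩
  ifPos (sum v) (multinomial 0 v) * K
    ≡⟨ ifPos-* (sum v) (multinomial 0 v) hi ⟩
  multinomial 0 v * weight⁻ (sum v) hi
    ≡⟨ cong₂ (λ m s → m * weight⁻ s hi) (multinomial-∷ʳ 0 lo h) Σv≡ ⟩
  multinomial 0 lo * ((sum lo + h) C h) * weight⁻ (sum lo + h) hi
    ≡⟨ *-assoc (multinomial 0 lo) _ _ ⟩
  multinomial 0 lo * weight (sum lo) (h ∷ hi) ∎
  where
  open ≡-Reasoning
  v = lo ++ h ∷ []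
  K = weight (pred (sum v)) hi
  a≡v++hi : toList a ≡ v ++ hi
  a≡v++hi = trans a≡ (sym (List.++-assoc lo (h ∷ []) hi))
  |v|≡ : length v ≡ suc k
  |v|≡ = trans (List.length-++ lo) (trans (+-comm (length lo) 1) (cong suc |lo|≡k))
  Σv≡ : sum v ≡ sum lo + h
  Σv≡ = trans (sum-++ lo (h ∷ [])) (cong (sum lo +_) (+-identityʳ h))

c≡weight : ∀ n (a : Vec ℕ n) → c n a ≡ weight 0 (toList a)
c≡weight n a = begin
  coeff a (p n)                                        ≡⟨ cong (coeff a) (p≡partialSumProduct n) ⟩
  coeff a (partialSumProduct n 0 n)                    ≡⟨ cong (coeff a ∘ partialSumProduct n 0) (length-toList a) ⟨
  coeff a (partialSumProduct n 0 (length (toList a))) ≡⟨ coeff-partialSumProduct (toList a) [] a refl refl ⟩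
  1 * weight 0 (toList a)                              ≡⟨ *-identityˡ (weight 0 (toList a)) ⟩
  weight 0 (toList a)                                  ∎
  where open ≡-Reasoning

-- Balancing moves

cross-multiply-≤ : ∀ a b c {u v} m .{{_ : NonZero m}} → a * m ≡ c * u → b * m ≡ c * v → u ≤ v → a ≤ b
cross-multiply-≤ a b c m am≡cu bm≡cv u≤v =
  *-cancelʳ-≤ a b m (subst₂ _≤_ (sym am≡cu) (sym bm≡cv) (*-monoʳ-≤ c u≤v))

module Exchange (s x y : ℕ) where
  open ≡-Reasoning

  private
    shuffle : ∀ a b c d → (a * b) * (c * d) ≡ (a * c) * (b * d)
    shuffle = solve-∀

    X Y : ℕ
    X = s C x
    Y = (s + y) C y

    left : (X * ((s + y) C suc y)) * (suc x * suc y) ≡ (X * Y) * (s * suc x)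
    left = begin
      (X * ((s + y) C suc y)) * (suc x * suc y) ≡⟨ shuffle X ((s + y) C suc y) (suc x) (suc y) ⟩
      (X * suc x) * (((s + y) C suc y) * suc y) ≡⟨ cong ((X * suc x) *_) ([s+k]C[k+1]*[k+1]≡[s+k]Ck*s s y) ⟩
      (X * suc x) * (Y * s)                    ≡⟨ shuffle X (suc x) Y s ⟩
      (X * Y) * (suc x * s)                    ≡⟨ cong ((X * Y) *_) (*-comm (suc x) s) ⟩
      (X * Y) * (s * suc x)                    ∎

    right : ((suc s C suc x) * Y) * (suc x * suc y) ≡ (X * Y) * (suc s * suc y)
    right = begin
      ((suc s C suc x) * Y) * (suc x * suc y) ≡⟨ shuffle (suc s C suc x) Y (suc x) (suc y) ⟩
      ((suc s C suc x) * suc x) * (Y * suc y) ≡⟨ cong (_* (Y * suc y)) ([n+1]C[k+1]*[k+1]≡nCk*[n+1] s x) ⟩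
      (X * suc s) * (Y * suc y)              ≡⟨ shuffle X (suc s) Y (suc y) ⟩
      (X * Y) * (suc s * suc y)              ∎

  exchange-≤ : s * suc x ≤ suc s * suc y → (s C x) * ((s + y) C suc y) ≤ (suc s C suc x) * ((s + y) C y)
  exchange-≤ = cross-multiply-≤ (X * ((s + y) C suc y)) ((suc s C suc x) * Y) (X * Y) (suc x * suc y) left right

  exchange-≥ : suc s * suc y ≤ s * suc x → (suc s C suc x) * ((s + y) C y) ≤ (s C x) * ((s + y) C suc y)
  exchange-≥ = cross-multiply-≤ ((suc s C suc x) * Y) (X * ((s + y) C suc y)) (X * Y) (suc x * suc y) right left

weight-suc∷ : ∀ u x ys → weight u (suc x ∷ ys) ≡ (suc (u + x) C suc x) * weight (u + x) ys
weight-suc∷ u x ys = cong (λ t → (t C suc x) * weight⁻ t ys) (+-suc u x)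

weight-raise : ∀ u {x y} r → x ≤ y → weight u (x ∷ suc y ∷ r) ≤ weight u (suc x ∷ y ∷ r)
weight-raise u {x} {y} r x≤y =
  subst (weight u (x ∷ suc y ∷ r) ≤_) (sym (weight-suc∷ u x (y ∷ r))) (go (u + x))
  where
  go : ∀ s → (s C x) * weight⁻ s (suc y ∷ r) ≤ (suc s C suc x) * weight s (y ∷ r)
  go zero rewrite *-zeroʳ (0 C x) = z≤n
  go s@(suc w) rewrite +-suc w y =
    subst₂ _≤_ (*-assoc (s C x) ((s + y) C suc y) G) (*-assoc (suc s C suc x) ((s + y) C y) G)
      (*-monoˡ-≤ G (Exchange.exchange-≤ s x y growth))
    where
    G = weight⁻ (s + y) r
    growth : s * suc x ≤ suc s * suc y
    growth = ≤-trans (*-monoʳ-≤ s (s≤s x≤y)) (*-monoˡ-≤ (suc y) (n≤1+n s))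

weight-lower : ∀ u {x y} r → y < x → weight u (suc x ∷ y ∷ r) ≤ weight u (x ∷ suc y ∷ r)
weight-lower u {x} {y} r y<x =
  subst (_≤ weight u (x ∷ suc y ∷ r)) (sym (weight-suc∷ u x (y ∷ r))) (go (u + x) (m≤n+m x u))
  where
  go : ∀ s → x ≤ s → (suc s C suc x) * weight s (y ∷ r) ≤ (s C x) * weight⁻ s (suc y ∷ r)
  go zero x≤0 = ⊥-elim (<⇒≱ y<x (≤-trans x≤0 z≤n))
  go s@(suc w) x≤s rewrite +-suc w y =
    subst₂ _≤_ (*-assoc (suc s C suc x) ((s + y) C y) G) (*-assoc (s C x) ((s + y) C suc y) G)
      (*-monoˡ-≤ G (Exchange.exchange-≥ s x y decay))
    where
    G = weight⁻ (s + y) r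
    decay : suc s * suc y ≤ s * suc x
    decay = begin
      suc s * suc y     ≡⟨ *-comm (suc s) (suc y) ⟩
      suc y * suc s     ≡⟨ *-suc (suc y) s ⟩
      suc y + suc y * s ≤⟨ +-monoˡ-≤ (suc y * s) (≤-trans y<x x≤s) ⟩
      s + suc y * s     ≡⟨⟩
      suc (suc y) * s   ≤⟨ *-monoˡ-≤ s (s≤s y<x) ⟩
      suc x * s         ≡⟨ *-comm (suc x) s ⟩
      s * suc x         ∎
      where open ≤-Reasoning

mutual
  weight-∷-mono : ∀ {a b : List ℕ} → (∀ u → weight u a ≤ weight u b) → ∀ u x → weight u (x ∷ a) ≤ weight u (x ∷ b)
  weight-∷-mono a≤b u x = *-monoʳ-≤ ((u + x) C x) (weight⁻-mono a≤b (u + x))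

  weight⁻-mono : ∀ {a b : List ℕ} → (∀ u → weight u a ≤ weight u b) → ∀ u → weight⁻ u a ≤ weight⁻ u b
  weight⁻-mono a≤b zero    = z≤n
  weight⁻-mono a≤b (suc u) = a≤b u

-- Σ aᵢ² + Σ (i − 1) aᵢ; each balancing move lowers it by at least one.
potential : List ℕ → ℕ
potential []       = 0
potential (x ∷ xs) = x * x + sum xs + potential xs

Balanced : ∀ {n} → Vec ℕ n → Set
Balanced (x ∷ y ∷ r) = (y ≤ x × x ≤ y + 1) × Balanced (y ∷ r)
Balanced _           = ⊤

Balanced⇒adjacent : ∀ {n} {a : Vec ℕ n} → Balanced a → ∀ (i j : Fin n) → toℕ j ≡ suc (toℕ i) →
                    (Vec.lookup a j ≤ Vec.lookup a i) × (Vec.lookup a i ≤ Vec.lookup a j + 1)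
Balanced⇒adjacent {a = x ∷ y ∷ r} (xy , _)  Fin.zero    (Fin.suc Fin.zero) _ = xy
Balanced⇒adjacent {a = x ∷ y ∷ r} (_ , bal) (Fin.suc i) (Fin.suc j)        j≡1+i =
  Balanced⇒adjacent bal i j (suc-injective j≡1+i)
Balanced⇒adjacent {a = x ∷ y ∷ r} _ Fin.zero (Fin.suc (Fin.suc _)) ()
Balanced⇒adjacent {a = x ∷ []}    _ Fin.zero (Fin.suc ())          _
Balanced⇒adjacent                 _ _        Fin.zero               ()

record Improvement {n} (a : Vec ℕ n) : Set where
  constructor improvement
  field
    improved    : Vec ℕ n
    potential-< : potential (toList improved) < potential (toList a)
    sum-≡       : sum (toList improved) ≡ sum (toList a)
    weight-≤    : ∀ u → weight u (toList a) ≤ weight u (toList improved)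

raise : ∀ {n} x y (r : Vec ℕ n) → x < y → Improvement (x ∷ y ∷ r)
raise x (suc y) r (s≤s x≤y) with m≤n⇒∃[o]m+o≡n x≤y
... | d , refl = improvement (suc x ∷ x + d ∷ r)
  (subst (P <_) (drop-excess x d (sum (toList r)) (potential (toList r))) (s≤s (m≤m+n P (2 * d))))
  (sym (+-suc x (x + d + sum (toList r))))
  (λ u → weight-raise u (toList r) (m≤m+n x d))
  where
  P = potential (toList (suc x ∷ x + d ∷ r))
  drop-excess : ∀ x d R Q →
    suc (suc x * suc x + (x + d + R) + ((x + d) * (x + d) + R + Q) + 2 * d)
      ≡ x * x + (suc (x + d) + R) + (suc (x + d) * suc (x + d) + R + Q)
  drop-excess = solve-∀

lower : ∀ {n} x y (r : Vec ℕ n) → suc (suc y) ≤ x → Improvement (x ∷ y ∷ r)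
lower x y r y+2≤x with m≤n⇒∃[o]m+o≡n y+2≤x
... | d , refl = improvement (suc (y + d) ∷ suc y ∷ r)
  (subst (P <_) (drop-excess y d (sum (toList r)) (potential (toList r))) (s≤s (m≤m+n P (2 * d))))
  (cong suc (+-suc (y + d) (y + sum (toList r))))
  (λ u → weight-lower u (toList r) (s≤s (m≤m+n y d)))
  where
  P = potential (toList (suc (y + d) ∷ suc y ∷ r))
  drop-excess : ∀ y d R Q →
    suc (suc (y + d) * suc (y + d) + (suc y + R) + (suc y * suc y + R + Q) + 2 * d)
      ≡ suc (suc (y + d)) * suc (suc (y + d)) + (y + R) + (y * y + R + Q)
  drop-excess = solve-∀

∷-improvement : ∀ {n} x {a : Vec ℕ n} → Improvement a → Improvement (x ∷ a)
∷-improvement x {a} (improvement b b<a Σb≡Σa b≥a) = improvement (x ∷ b)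
  (subst (λ t → x * x + t + potential (toList b) < potential (toList (x ∷ a))) (sym Σb≡Σa)
    (+-monoʳ-< (x * x + sum (toList a)) b<a))
  (cong (x +_) Σb≡Σa)
  (λ u → weight-∷-mono b≥a u x)

improve : ∀ {n} (a : Vec ℕ n) → Balanced a ⊎ Improvement a
improve []          = inj₁ tt
improve (x ∷ [])    = inj₁ tt
improve (x ∷ y ∷ r) with y ≤? x | x ≤? y + 1 | improve (y ∷ r)
... | no  y≰x | _         | _              = inj₂ (raise x y r (≰⇒> y≰x))
... | yes _   | no x≰y+1  | _              = inj₂ (lower x y r (subst (_< x) (+-comm y 1) (≰⇒> x≰y+1)))
... | yes y≤x | yes x≤y+1 | inj₁ balanced = inj₁ ((y≤x , x≤y+1) , balanced)
... | yes _   | yes _     | inj₂ better   = inj₂ (∷-improvement x better)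

balance : ∀ {n} (a : Vec ℕ n) → Acc _<_ (potential (toList a)) →
          ∃ λ b → Balanced b × weight 0 (toList a) ≤ weight 0 (toList b)
balance a (acc smaller) with improve a
... | inj₁ balanced = a , balanced , ≤-refl
... | inj₂ (improvement b b<a _ b≥a) with balance b (smaller b<a)
...   | c , balanced , c≥b = c , balanced , ≤-trans (b≥a 0) c≥b

positive-*ʳ : ∀ m {n} → 0 < m * n → 0 < n
positive-*ʳ m {zero}  m*0>0 = subst (0 <_) (*-zeroʳ m) m*0>0
positive-*ʳ m {suc n} _     = z<s

weight-∷-positive : ∀ u x xs → 0 < weight u (x ∷ xs) → ∃ λ w → u + x ≡ suc w × 0 < weight w xs
weight-∷-positive u x xs pos with u + x | pos
... | zero  | p = ⊥-elim (<-irrefl refl (positive-*ʳ (0 C x) p))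
... | suc w | p = w , refl , positive-*ʳ (suc w C x) p

weight-positive⇒sum : ∀ u xs → 0 < weight u xs → u + sum xs ≡ length xs
weight-positive⇒sum zero    []       _   = refl
weight-positive⇒sum u       (x ∷ xs) pos with weight-∷-positive u x xs pos
... | w , u+x≡1+w , pos′ = begin
  u + (x + sum xs) ≡⟨ +-assoc u x (sum xs) ⟨
  u + x + sum xs   ≡⟨ cong (_+ sum xs) u+x≡1+w ⟩
  suc (w + sum xs) ≡⟨ cong suc (weight-positive⇒sum w xs pos′) ⟩
  suc (length xs)  ∎
  where open ≡-Reasoning

weight-positive⇒drop : ∀ k u xs → 0 < weight u xs → sum (drop k xs) ≤ length xs ∸ k
weight-positive⇒drop zero    u xs       pos =
  subst (sum xs ≤_) (weight-positive⇒sum u xs pos) (m≤n+m (sum xs) u)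
weight-positive⇒drop (suc k) u []       _   = z≤n
weight-positive⇒drop (suc k) u (x ∷ xs) pos with weight-∷-positive u x xs pos
... | w , _ , pos′ = weight-positive⇒drop k w xs pos′

weight-positive⇒InA : ∀ n (a : Vec ℕ n) → 0 < weight 0 (toList a) → InA n a
weight-positive⇒InA n a pos =
  (λ k _ _ → subst (λ m → sum (drop k (toList a)) ≤ m ∸ k) (length-toList a)
                   (weight-positive⇒drop k 0 (toList a) pos))
  , trans (weight-positive⇒sum 0 (toList a) pos) (length-toList a)

coeff-positive⇒∈ : ∀ {n} {a : Vec ℕ n} q → 0 < coeff a q → a ∈ q
coeff-positive⇒∈ {a = a} q pos with filter (λ m → ≡-dec _≟_ m a) q in eq
... | m ∷ _ with ∈-filter⁻ (λ m → ≡-dec _≟_ m a) {xs = q} (subst (m ∈_) (sym eq) (here refl))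
...   | m∈q , refl = m∈q

c-ones : ∀ n → c n (replicate n 1) ≡ 1
c-ones n = trans (c≡weight n (replicate n 1)) (go n)
  where
  go : ∀ n → weight 0 (toList (replicate n 1)) ≡ 1
  go zero    = refl
  go (suc n) = trans (*-identityˡ _) (go n)

theorem1 : (n : ℕ) → 1 ≤ n →
    Σ (Vec ℕ n) (λ a → InM n a × ((b : Vec ℕ n) → InA n b → c n b ≤ c n a))
theorem1 n _ = conclude (balance best (<-wellFounded _))
  where
  -- c n vanishes off the list p n, so maximising over that list is enough.
  best : Vec ℕ n
  best = argmax (c n) (replicate n 1) (p n)

  best-maximal : ∀ b → c n b ≤ c n best
  best-maximal b with c n b in cb
  ... | zero  = z≤n
  ... | suc _ = subst (_≤ c n best) cb
    (All.lookup (f[xs]≤f[argmax] (replicate n 1) (p n)) (coeff-positive⇒∈ (p n) (subst (0 <_) (sym cb) z<s)))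

  conclude : (∃ λ a → Balanced a × weight 0 (toList best) ≤ weight 0 (toList a)) →
             Σ (Vec ℕ n) (λ a → InM n a × ((b : Vec ℕ n) → InA n b → c n b ≤ c n a))
  conclude (a , balanced , best≤a) =
    a , (weight-positive⇒InA n a (subst (0 <_) (c≡weight n a) 1≤ca) , Balanced⇒adjacent balanced)
      , λ b _ → ≤-trans (best-maximal b) best≤a′
    where
    best≤a′ : c n best ≤ c n a
    best≤a′ = subst₂ _≤_ (sym (c≡weight n best)) (sym (c≡weight n a)) best≤a
    1≤ca : 1 ≤ c n a
    1≤ca = ≤-trans (subst (_≤ c n best) (c-ones n) (best-maximal (replicate n 1))) best≤a′
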